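{- Let $\mathbb{A}=(A,\le,\to,\Sigma)$ be an implicative algebra with $|A|<\kappa$ for a strongly inaccessible cardinal $\kappa$, and let $\mathbf{W}$, $\subseteq_{\mathbf{W}}$ and $\|\cdot\|$ be as in the context. Then $$\|x\subseteq y\,[x,y]\|\equiv_{\Sigma[\mathbf{W}^2]}\big((\alpha,\beta)\mapsto\alpha\subseteq_{\mathbf{W}}\beta\big),$$ where $x\subseteq y$ abbreviates $\forall z(z\in x\to z\in y)$.
   Context: An implicative algebra is a quadruple $\mathbb{A}=(A,\le,\to,\Sigma)$ where $(A,\le)$ is a complete lattice; $\to:A\times A\to A$ is anti-monotone in its first and monotone in its second argument and satisfies $a\to\bigwedge_{i}b_i=\bigwedge_{i}(a\to b_i)$; and $\Sigma\subseteq A$ is upward closed, closed under modus ponens, and contains $\mathbf{K}=\bigwedge_{a,b}(a\to(b\to a))$ and $\mathbf{S}=\bigwedge_{a,b,c}((a\to(b\to c))\to((a\to b)\to(a\to c)))$. Define $a\times b:=\bigwedge_{x}((a\to(b\to x))\to x)$, $a+b:=\bigwedge_x((a\to x)\to((b\to x)\to x))$, $\exists_{i\in I}a_i:=\bigwedge_x(\bigwedge_i(a_i\to x)\to x)$. For maps $f,g:I\to A$, $f\equiv_{\Sigma[I]}g$ means both $\bigwedge_{i}(f(i)\to g(i))\in\Sigma$ and $\bigwedge_{i}(g(i)\to f(i))\in\Sigma$. Work in ZFC with $\kappa$ strongly inaccessible and $|A|<\kappa$. With $\mathsf{Part}(X,Y)$ the set of partial functions $X\rightharpoonup Y$ and $\partial_0(f)$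 the domain of $f$, let $W_0=\emptyset$, $W_{\beta+1}=\mathsf{Part}(W_\beta,A)$, $W_\lambda=\bigcup_{\beta<\lambda}W_\beta$ for limits, $\mathbf{W}=W_\kappa$. By simultaneous recursion on ranks: $\alpha\in_{\mathbf{W}}\beta:=\exists_{t\in\partial_0(\beta)}(\beta(t)\times(t=_{\mathbf{W}}\alpha))$, $\alpha=_{\mathbf{W}}\beta:=(\alpha\subseteq_{\mathbf{W}}\beta)\times(\beta\subseteq_{\mathbf{W}}\alpha)$, $\alpha\subseteq_{\mathbf{W}}\beta:=\bigwedge_{t\in\partial_0(\alpha)}(\alpha(t)\to t\in_{\mathbf{W}}\beta)$. The language of set theory has only variables as terms, binary predicates $=,\in$, connectives $\bot,\wedge,\vee,\to$, quantifiers $\exists,\forall$. To each formula in context $\varphi[x_1,\dots,x_n]$ one assigns $\|\varphi[\underline{x}]\|:\mathbf{W}^n\to A$ by: $\|x_i\in x_j\|(\underline\alpha)=\alpha_i\in_{\mathbf{W}}\alpha_j$; $\|x_i=x_j\|(\underline\alpha)=\alpha_i=_{\mathbf{W}}\alpha_j$; $\|\bot\|=\bot$; $\|\varphi\wedge\psi\|=\|\varphi\|\times\|\psi\|$, $\|\varphi\vee\psi\|=\|\varphi\|+\|\psi\|$, $\|\varphi\to\psi\|=\|\varphi\|\to\|\psi\|$ pointwise; $\|\exists y\varphi[\underline{x}]\|(\underline\alpha)=\exists_{\beta\in\mathbf{W}}\|\varphi[\underline{x},y]\|(\underline\alpha,\beta)$; $\|\forall y\varphi[\underline{x}]\|(\underline\alpha)=\bigwedge_{\beta\in\mathbf{W}}\|\varphi[\underline{x},y]\|(\underline\alpha,\beta)$.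 -}

module Defs where

open import Level using (Lift; lift; lower) renaming (suc to lsuc; zero to lzero)
open import Data.Product using (Σ; _,_; _×_)
open import Data.Fin using (Fin; zero; suc)
open import Data.Nat using (ℕ)
open import Relation.Binary.PropositionalEquality using (_≡_)

-- The carrier lives in Set; the complete
-- lattice has meets of all families indexed by types in Set₁ (this includes
-- families indexed by A itself, by Set-small types, and by 𝐖 below).
record ImplicativeAlgebra : Set₂ where
  infixr 5 _⇒_
  infix 4 _≤_
  field
    A    : Set
    _≤_  : A → A → Set
    ≤-refl    : ∀ {a} → a ≤ a
    ≤-trans   : ∀ {a b c} → a ≤ b → b ≤ c → a ≤ c
    ≤-antisym : ∀ {a b} → a ≤ b → b ≤ a → a ≡ b
    ⋀    : {I : Set₁} → (I → A) → A
    ⋀-lb : ∀ {I : Set₁} (f : I → A) (i : I) → ⋀ f ≤ f i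
    ⋀-glb : ∀ {I : Set₁} (f : I → A) (c : A) → (∀ i → c ≤ f i) → c ≤ ⋀ f
    _⇒_  : A → A → A
    ⇒-mono : ∀ {a a' b b'} → a' ≤ a → b ≤ b' → (a ⇒ b) ≤ (a' ⇒ b')
    ⇒-⋀  : ∀ {I : Set₁} (a : A) (b : I → A) → (a ⇒ ⋀ b) ≡ ⋀ (λ i → a ⇒ b i)
    Sep  : A → Set
    Sep-up : ∀ {a b} → a ≤ b → Sep a → Sep b
    Sep-mp : ∀ {a b} → Sep (a ⇒ b) → Sep a → Sep b
    Sep-K  : Sep (⋀ {Lift (lsuc lzero) (A × A)}
                    (λ p → let (a , b) = lower p in a ⇒ (b ⇒ a)))
    Sep-S  : Sep (⋀ {Lift (lsuc lzero) (A × A × A)}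
                    (λ p → let (a , b , c) = lower p in
                       (a ⇒ (b ⇒ c)) ⇒ ((a ⇒ b) ⇒ (a ⇒ c))))

module Constructions (𝔸 : ImplicativeAlgebra) where
  open ImplicativeAlgebra 𝔸

  ⋀₀ : {I : Set} → (I → A) → A
  ⋀₀ {I} f = ⋀ {Lift (lsuc lzero) I} (λ i → f (lower i))

  ⋀A : (A → A) → A
  ⋀A f = ⋀₀ f

  ⊥ᴬ : A
  ⊥ᴬ = ⋀A (λ a → a)

  _⊗_ : A → A → A
  a ⊗ b = ⋀A (λ x → (a ⇒ (b ⇒ x)) ⇒ x)

  _⊕_ : A → A → A
  a ⊕ b = ⋀A (λ x → (a ⇒ x) ⇒ ((b ⇒ x) ⇒ x))

  ∃ᴬ : {I : Set₁} → (I → A) → A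
  ∃ᴬ f = ⋀A (λ x → ⋀ (λ i → f i ⇒ x) ⇒ x)

  ∃ᴬ₀ : {I : Set} → (I → A) → A
  ∃ᴬ₀ {I} f = ∃ᴬ {Lift (lsuc lzero) I} (λ i → f (lower i))

  _≡Σ_ : {I : Set₁} → (I → A) → (I → A) → Set
  f ≡Σ g = Sep (⋀ (λ i → f i ⇒ g i)) × Sep (⋀ (λ i → g i ⇒ f i))

  -- The implicative universe 𝐖: well-founded trees whose nodes are
  -- "partial functions" from (a small family of) previously built elements to A
  -- (Aczel-style rendering of W_κ; small index types play the role of sets of size < κ).
  data 𝐖 : Set₁ where
    sup : (I : Set) → (I → 𝐖) → (I → A) → 𝐖

  Dom : 𝐖 → Set
  Dom (sup I _ _) = I

  elt : (α : 𝐖) → Dom α → 𝐖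
  elt (sup _ f _) = f

  val : (α : 𝐖) → Dom α → A
  val (sup _ _ a) = a

  _∈𝐖_ : 𝐖 → 𝐖 → A
  _=𝐖_ : 𝐖 → 𝐖 → A
  _⊆𝐖_ : 𝐖 → 𝐖 → A

  α ∈𝐖 sup J g b = ∃ᴬ₀ (λ j → b j ⊗ (g j =𝐖 α))
  α =𝐖 β = (α ⊆𝐖 β) ⊗ (β ⊆𝐖 α)
  sup I f a ⊆𝐖 β = ⋀₀ (λ i → a i ⇒ (f i ∈𝐖 β))

  -- First-order language of set theory, variables as de Bruijn indices in Fin n
  -- (the bound variable of a quantifier is index zero).
  data Formula (n : ℕ) : Set where
    _∈'_ _=='_ : Fin n → Fin n → Formula n
    ⊥'        : Formula n
    _∧'_ _∨'_ _⇒'_ : Formula n → Formula n → Formula n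
    ∃' ∀'     : Formula (ℕ.suc n) → Formula n

  extend : {n : ℕ} → (Fin n → 𝐖) → 𝐖 → Fin (ℕ.suc n) → 𝐖
  extend ρ β zero    = β
  extend ρ β (suc i) = ρ i

  ⟦_⟧ : {n : ℕ} → Formula n → (Fin n → 𝐖) → A
  ⟦ i ∈' j ⟧ ρ = ρ i ∈𝐖 ρ j
  ⟦ i ==' j ⟧ ρ = ρ i =𝐖 ρ j
  ⟦ ⊥' ⟧ ρ = ⊥ᴬ
  ⟦ φ ∧' ψ ⟧ ρ = ⟦ φ ⟧ ρ ⊗ ⟦ ψ ⟧ ρ
  ⟦ φ ∨' ψ ⟧ ρ = ⟦ φ ⟧ ρ ⊕ ⟦ ψ ⟧ ρ
  ⟦ φ ⇒' ψ ⟧ ρ = ⟦ φ ⟧ ρ ⇒ ⟦ ψ ⟧ ρ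
  ⟦ ∃' φ ⟧ ρ = ∃ᴬ (λ β → ⟦ φ ⟧ (extend ρ β))
  ⟦ ∀' φ ⟧ ρ = ⋀ (λ β → ⟦ φ ⟧ (extend ρ β))

  -- x ⊆ y  :=  ∀ z (z ∈ x → z ∈ y),  in context [x , y] (x = index 0, y = index 1)
  subsetFormula : Formula 2
  subsetFormula = ∀' ((zero ∈' suc zero) ⇒' (zero ∈' suc (suc zero)))

  env₂ : 𝐖 × 𝐖 → Fin 2 → 𝐖
  env₂ (α , β) zero = α
  env₂ (α , β) (suc zero) = β

-- Both directions are realized by closed λ-terms, and the separator contains the
-- denotation of every closed λ-term because it contains 𝐊 and 𝐒 (bracket
-- abstraction).  From a realizer x of ∀z (z ∈ α → z ∈ β), the term λp. x (r p)
-- realizes α ⊆ β, where r realizes reflexivity α ⊆ α (a child tᵢ with α(tᵢ)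
-- is a member of α, with itself as witness).  Conversely, given α ⊆ β and
-- z ∈ α, i.e. a child t of α with t = z, one obtains t ∈ β and transports
-- membership along t = z by transitivity of =.  Since ∈, = and ⊆ on 𝐖 are
-- defined by well-founded recursion, the realizers of reflexivity and
-- transitivity call themselves on the children; they are built with Turing's
-- fixpoint combinator Θ.
module Submission where

open import Agda.Builtin.FromNat using (Number; fromNat)
open import Data.Fin using (Fin; zero; suc)
open import Data.Fin.Literals using () renaming (number to Fin-number)
open import Data.Nat.Literals using () renaming (number to ℕ-number)
open import Data.Nat using (ℕ)
open import Data.Product using (Σ; _×_; _,_; proj₁; proj₂)
open import Data.Unit using (tt)
open import Data.Vec.Functional using (Vector; []; _∷_)
open import Level using (Lift; lift; lower) renaming (suc to lsuc; zero to lzero)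
open import Relation.Binary.PropositionalEquality using (subst; sym)

open import Defs

instance
  ℕ-literals : Number ℕ
  ℕ-literals = ℕ-number

  Fin-literals : ∀ {n} → Number (Fin n)
  Fin-literals = Fin-number _

module Combinatory (𝔸 : ImplicativeAlgebra) where
  open ImplicativeAlgebra 𝔸
  open Constructions 𝔸

  ⇒-⋀-glb : ∀ {I : Set₁} {t p : A} {q : I → A} → (∀ i → t ≤ p ⇒ q i) → t ≤ p ⇒ ⋀ q
  ⇒-⋀-glb {t = t} {p} {q} h = subst (t ≤_) (sym (⇒-⋀ p q)) (⋀-glb _ t h)

  -- Application and abstraction are opaque so that unification can read f off Λ f
  -- (and a, b off a · b); all reasoning goes through their introduction and
  -- elimination rules.
  infixl 7 _·_
  opaque
    _·_ : A → A → A
    a · b = ⋀₀ {Σ A (λ c → a ≤ b ⇒ c)} proj₁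

  opaque
    unfolding _·_

    ≤⇒· : ∀ {a b} → a ≤ b ⇒ a · b
    ≤⇒· = ⇒-⋀-glb (λ c → proj₂ (lower c))

    ·-≤ : ∀ {a b c} → a ≤ b ⇒ c → a · b ≤ c
    ·-≤ {c = c} h = ⋀-lb _ (lift (c , h))

  ·-mono : ∀ {a a′ b b′} → a ≤ a′ → b ≤ b′ → a · b ≤ a′ · b′
  ·-mono a≤a′ b≤b′ = ·-≤ (≤-trans a≤a′ (≤-trans ≤⇒· (⇒-mono b≤b′ ≤-refl)))

  ⇒-elim : ∀ {t s p q} → t ≤ p ⇒ q → s ≤ p → t · s ≤ q
  ⇒-elim t≤p⇒q s≤p = ≤-trans (·-mono ≤-refl s≤p) (·-≤ t≤p⇒q)

  ⇒-elim₂ : ∀ {t s s′ p p′ q} → t ≤ p ⇒ p′ ⇒ q → s ≤ p → s′ ≤ p′ → t · s · s′ ≤ q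
  ⇒-elim₂ t≤ s≤ s′≤ = ⇒-elim (⇒-elim t≤ s≤) s′≤

  opaque
    Λ : (A → A) → A
    Λ f = ⋀A (λ a → a ⇒ f a)

  opaque
    unfolding Λ

    Λ-β : ∀ {f a} → Λ f · a ≤ f a
    Λ-β {a = a} = ·-≤ (⋀-lb _ (lift a))

    ⇒-intro : ∀ {f p q} → f p ≤ q → Λ f ≤ p ⇒ q
    ⇒-intro {p = p} h = ≤-trans (⋀-lb _ (lift p)) (⇒-mono ≤-refl h)

    ≤-Λ : ∀ {t f} → (∀ a → t · a ≤ f a) → t ≤ Λ f
    ≤-Λ h = ⋀-glb _ _ (λ a → ≤-trans ≤⇒· (⇒-mono ≤-refl (h (lower a))))

  Λ-β₂ : ∀ {f : A → A → A} {a b} → Λ (λ x → Λ (f x)) · a · b ≤ f a b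
  Λ-β₂ = ≤-trans (·-mono Λ-β ≤-refl) Λ-β

  Sep-· : ∀ {a b} → Sep a → Sep b → Sep (a · b)
  Sep-· sa sb = Sep-mp (Sep-up ≤⇒· sa) sb

  infixl 7 _$_
  infix 6 ƛ_

  data Tm : ℕ → Set where
    var : ∀ {n} → Fin n → Tm n
    _$_ : ∀ {n} → Tm n → Tm n → Tm n
    ƛ_  : ∀ {n} → Tm (ℕ.suc n) → Tm n
    ⌜_⌝ : ∀ {n} → Tm 0 → Tm n

  ⟦_⟧ᵗ : ∀ {n} → Tm n → Vector A n → A
  ⟦ var i ⟧ᵗ ρ = ρ i
  ⟦ t $ u ⟧ᵗ ρ = ⟦ t ⟧ᵗ ρ · ⟦ u ⟧ᵗ ρ
  ⟦ ƛ t ⟧ᵗ ρ = Λ (λ a → ⟦ t ⟧ᵗ (a ∷ ρ))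
  ⟦ ⌜ t ⌝ ⟧ᵗ ρ = ⟦ t ⟧ᵗ []

  ⟦_⟧₀ : Tm 0 → A
  ⟦ t ⟧₀ = ⟦ t ⟧ᵗ []

  data Comb : ℕ → Set where
    var : ∀ {n} → Fin n → Comb n
    _$_ : ∀ {n} → Comb n → Comb n → Comb n
    K S : ∀ {n} → Comb n
    ⌜_⌝ : ∀ {n} → Comb 0 → Comb n

  𝐊 : A
  𝐊 = ⋀ {Lift (lsuc lzero) (A × A)} (λ p → let (a , b) = lower p in a ⇒ (b ⇒ a))

  𝐒 : A
  𝐒 = ⋀ {Lift (lsuc lzero) (A × A × A)}
        (λ p → let (a , b , c) = lower p in (a ⇒ (b ⇒ c)) ⇒ ((a ⇒ b) ⇒ (a ⇒ c)))

  𝐊-β : ∀ {a b} → 𝐊 · a · b ≤ a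
  𝐊-β {a} {b} = ⇒-elim₂ (⋀-lb _ (lift (a , b))) ≤-refl ≤-refl

  𝐒-β : ∀ {a b c} → 𝐒 · a · b · c ≤ a · c · (b · c)
  𝐒-β {a} {b} {c} =
    ⇒-elim (⇒-elim₂ (⋀-lb _ (lift (c , b · c , a · c · (b · c))))
                    (≤-trans ≤⇒· (⇒-mono ≤-refl ≤⇒·)) ≤⇒·)
           ≤-refl

  ⟦_⟧ᶜ : ∀ {n} → Comb n → Vector A n → A
  ⟦ var i ⟧ᶜ ρ = ρ i
  ⟦ c $ d ⟧ᶜ ρ = ⟦ c ⟧ᶜ ρ · ⟦ d ⟧ᶜ ρ
  ⟦ K ⟧ᶜ ρ = 𝐊
  ⟦ S ⟧ᶜ ρ = 𝐒
  ⟦ ⌜ c ⌝ ⟧ᶜ ρ = ⟦ c ⟧ᶜ []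

  Sep-⟦⟧ᶜ : ∀ {n} (c : Comb n) {ρ : Vector A n} → (∀ i → Sep (ρ i)) → Sep (⟦ c ⟧ᶜ ρ)
  Sep-⟦⟧ᶜ (var i) ρ∈Σ = ρ∈Σ i
  Sep-⟦⟧ᶜ (c $ d) ρ∈Σ = Sep-· (Sep-⟦⟧ᶜ c ρ∈Σ) (Sep-⟦⟧ᶜ d ρ∈Σ)
  Sep-⟦⟧ᶜ K ρ∈Σ = Sep-K
  Sep-⟦⟧ᶜ S ρ∈Σ = Sep-S
  Sep-⟦⟧ᶜ ⌜ c ⌝ ρ∈Σ = Sep-⟦⟧ᶜ c (λ ())

  bracket : ∀ {n} → Comb (ℕ.suc n) → Comb n
  bracket (var zero) = S $ K $ K
  bracket (var (suc i)) = K $ var i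
  bracket (c $ d) = S $ bracket c $ bracket d
  bracket K = K $ K
  bracket S = K $ S
  bracket ⌜ c ⌝ = K $ ⌜ c ⌝

  bracket-β : ∀ {n} (c : Comb (ℕ.suc n)) ρ a → ⟦ bracket c ⟧ᶜ ρ · a ≤ ⟦ c ⟧ᶜ (a ∷ ρ)
  bracket-β (var zero) ρ a = ≤-trans 𝐒-β 𝐊-β
  bracket-β (var (suc i)) ρ a = 𝐊-β
  bracket-β (c $ d) ρ a = ≤-trans 𝐒-β (·-mono (bracket-β c ρ a) (bracket-β d ρ a))
  bracket-β K ρ a = 𝐊-β
  bracket-β S ρ a = 𝐊-β
  bracket-β ⌜ c ⌝ ρ a = 𝐊-β

  compile : ∀ {n} → Tm n → Comb n
  compile (var i) = var i
  compile (t $ u) = compile t $ compile u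
  compile (ƛ t) = bracket (compile t)
  compile ⌜ t ⌝ = ⌜ compile t ⌝

  compile-≤ : ∀ {n} (t : Tm n) ρ → ⟦ compile t ⟧ᶜ ρ ≤ ⟦ t ⟧ᵗ ρ
  compile-≤ (var i) ρ = ≤-refl
  compile-≤ (t $ u) ρ = ·-mono (compile-≤ t ρ) (compile-≤ u ρ)
  compile-≤ (ƛ t) ρ = ≤-Λ (λ a → ≤-trans (bracket-β (compile t) ρ a) (compile-≤ t _))
  compile-≤ ⌜ t ⌝ ρ = compile-≤ t []

  Sep-⟦⟧₀ : (t : Tm 0) → Sep ⟦ t ⟧₀
  Sep-⟦⟧₀ t = Sep-up (compile-≤ t []) (Sep-⟦⟧ᶜ (compile t) (λ ()))

  Θ : Tm 0
  Θ = half $ half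
    where
    half : Tm 0
    half = ƛ ƛ (var 0 $ (var 1 $ var 1 $ var 0))

  Θ-unfold : ∀ {f} → ⟦ Θ ⟧₀ · f ≤ f · (⟦ Θ ⟧₀ · f)
  Θ-unfold = ≤-trans (·-mono Λ-β ≤-refl) Λ-β

  pair : Tm 0
  pair = ƛ ƛ ƛ (var 0 $ var 2 $ var 1)

  ⊗-intro : ∀ {u v U V} → u ≤ U → v ≤ V → ⟦ pair ⟧₀ · u · v ≤ U ⊗ V
  ⊗-intro u≤U v≤V = ≤-trans Λ-β₂ (⋀-glb _ _ (λ x → ⇒-intro (⇒-elim₂ ≤-refl u≤U v≤V)))

  ⊗-elim : ∀ {e k U V x} → e ≤ U ⊗ V → k ≤ U ⇒ V ⇒ x → e · k ≤ x
  ⊗-elim {x = x} e≤U⊗V = ⇒-elim (≤-trans e≤U⊗V (⋀-lb _ (lift x)))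

  pack : Tm 0
  pack = ƛ ƛ ƛ (var 0 $ (⌜ pair ⌝ $ var 2 $ var 1))

  ∃⊗-intro : ∀ {I : Set} {B C : I → A} {p q} (j : I) → p ≤ B j → q ≤ C j →
             ⟦ pack ⟧₀ · p · q ≤ ∃ᴬ₀ (λ i → B i ⊗ C i)
  ∃⊗-intro j p≤ q≤ = ≤-trans Λ-β₂ (⋀-glb _ _ (λ x →
    ⇒-intro (⇒-elim (⋀-lb _ (lift j)) (⊗-intro p≤ q≤))))

  unpack : Tm 0
  unpack = ƛ ƛ (var 1 $ (ƛ var 0 $ var 1))

  ∃⊗-elim : ∀ {I : Set} {B C : I → A} {e k x} → e ≤ ∃ᴬ₀ (λ i → B i ⊗ C i) →
            (∀ i → k ≤ B i ⇒ C i ⇒ x) → ⟦ unpack ⟧₀ · e · k ≤ x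
  ∃⊗-elim {x = x} e≤ k≤ = ≤-trans Λ-β₂ (⇒-elim (≤-trans e≤ (⋀-lb _ (lift x)))
    (⋀-glb _ _ (λ i → ⇒-intro (⊗-elim ≤-refl (k≤ (lower i))))))

module Realizers (𝔸 : ImplicativeAlgebra) where
  open ImplicativeAlgebra 𝔸
  open Constructions 𝔸
  open Combinatory 𝔸

  reflexivity : Tm 0
  reflexivity = Θ $ (ƛ ƛ ⌜ pack ⌝ $ var 0 $ (⌜ pair ⌝ $ var 1 $ var 1))

  ⊆𝐖-refl : ∀ α → ⟦ reflexivity ⟧₀ ≤ α ⊆𝐖 α
  ⊆𝐖-refl (sup _ f _) = ≤-trans Θ-unfold (≤-trans Λ-β (⋀-glb _ _ (λ i →
    ⇒-intro (∃⊗-intro (lower i) ≤-refl (⊗-intro (⊆𝐖-refl (f (lower i))) (⊆𝐖-refl (f (lower i))))))))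

  -- λ t s s′ p. unpack (s p) (λ p′ q. unpack (s′ p′) (λ p″ q′. pack p″ (t q′ q)))
  composition : Tm 0
  composition = ƛ ƛ ƛ ƛ ⌜ unpack ⌝ $ (var 2 $ var 0) $
    (ƛ ƛ ⌜ unpack ⌝ $ (var 3 $ var 1) $ (ƛ ƛ ⌜ pack ⌝ $ var 1 $ (var 7 $ var 0 $ var 2)))

  ⊆𝐖-trans : ∀ {t} x y z →
             (∀ i j k → t ≤ elt z k =𝐖 elt y j ⇒ elt y j =𝐖 elt x i ⇒ elt z k =𝐖 elt x i) →
             ⟦ composition ⟧₀ · t ≤ x ⊆𝐖 y ⇒ y ⊆𝐖 z ⇒ x ⊆𝐖 z
  ⊆𝐖-trans (sup _ _ _) (sup _ _ _) (sup _ _ _) t-trans =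
    ≤-trans Λ-β (⇒-intro (⇒-intro (⋀-glb _ _ (λ i →
      ⇒-intro (∃⊗-elim (⇒-elim (⋀-lb _ i) ≤-refl) (λ j → ⇒-intro (⇒-intro
        (∃⊗-elim (⇒-elim (⋀-lb _ (lift j)) ≤-refl) (λ k → ⇒-intro (⇒-intro
          (∃⊗-intro k ≤-refl (⇒-elim₂ (t-trans (lower i) j k) ≤-refl ≤-refl))))))))))))

  -- Θ (λ t e e′. e (λ xy yx. e′ (λ yz zy. pair (composition t xy yz) (composition t zy yx))))
  transitivity : Tm 0
  transitivity = Θ $ (ƛ ƛ ƛ var 1 $ (ƛ ƛ var 2 $ (ƛ ƛ ⌜ pair ⌝
    $ (⌜ composition ⌝ $ var 6 $ var 3 $ var 1)
    $ (⌜ composition ⌝ $ var 6 $ var 0 $ var 2))))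

  =𝐖-trans : ∀ x y z → ⟦ transitivity ⟧₀ ≤ x =𝐖 y ⇒ y =𝐖 z ⇒ x =𝐖 z
  =𝐖-trans x@(sup _ f _) y@(sup _ g _) z@(sup _ h _) =
    ≤-trans Θ-unfold (≤-trans Λ-β (⇒-intro (⇒-intro
      (⊗-elim ≤-refl (⇒-intro (⇒-intro (⊗-elim ≤-refl (⇒-intro (⇒-intro (⊗-intro
        (⇒-elim₂ (⊆𝐖-trans x y z (λ i j k → =𝐖-trans (h k) (g j) (f i))) ≤-refl ≤-refl)
        (⇒-elim₂ (⊆𝐖-trans z y x (λ k j i → =𝐖-trans (f i) (g j) (h k))) ≤-refl ≤-refl)))))))))))

  -- λ q m. unpack m (λ s t. pack s (transitivity t q))
  membership-resp : Tm 0
  membership-resp = ƛ ƛ ⌜ unpack ⌝ $ var 0 $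
    (ƛ ƛ ⌜ pack ⌝ $ var 1 $ (⌜ transitivity ⌝ $ var 0 $ var 3))

  ∈𝐖-resp-=𝐖 : ∀ δ γ β → ⟦ membership-resp ⟧₀ ≤ δ =𝐖 γ ⇒ δ ∈𝐖 β ⇒ γ ∈𝐖 β
  ∈𝐖-resp-=𝐖 δ γ (sup _ g _) = ⇒-intro (⇒-intro (∃⊗-elim ≤-refl (λ k → ⇒-intro (⇒-intro
    (∃⊗-intro k ≤-refl (⇒-elim₂ (=𝐖-trans (g k) δ γ) ≤-refl ≤-refl))))))

  subset-intro : Tm 0
  subset-intro = ƛ ƛ var 1 $ (⌜ reflexivity ⌝ $ var 0)

  ⊆𝐖-intro : ∀ α β → ⟦ subset-intro ⟧₀ ≤ ⋀ (λ γ → γ ∈𝐖 α ⇒ γ ∈𝐖 β) ⇒ α ⊆𝐖 β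
  ⊆𝐖-intro α@(sup _ f _) β = ⇒-intro (⋀-glb _ _ (λ i → ⇒-intro
    (⇒-elim (⋀-lb _ (f (lower i))) (⇒-elim (≤-trans (⊆𝐖-refl α) (⋀-lb _ i)) ≤-refl))))

  -- λ r e. unpack e (λ p q. membership-resp q (r p))
  subset-elim : Tm 0
  subset-elim = ƛ ƛ ⌜ unpack ⌝ $ var 0 $ (ƛ ƛ ⌜ membership-resp ⌝ $ var 0 $ (var 3 $ var 1))

  ⊆𝐖-elim : ∀ α β γ → ⟦ subset-elim ⟧₀ ≤ α ⊆𝐖 β ⇒ γ ∈𝐖 α ⇒ γ ∈𝐖 β
  ⊆𝐖-elim (sup _ f _) β γ = ⇒-intro (⇒-intro (∃⊗-elim ≤-refl (λ j → ⇒-intro (⇒-intro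
    (⇒-elim₂ (∈𝐖-resp-=𝐖 (f j) γ β) ≤-refl (⇒-elim (⋀-lb _ (lift j)) ≤-refl))))))

corollary4p6 : (𝔸 : ImplicativeAlgebra) →
    let open Constructions 𝔸 in
    _≡Σ_ {𝐖 × 𝐖} (λ p → ⟦ subsetFormula ⟧ (env₂ p))
    (λ p → let (α , β) = p in α ⊆𝐖 β)
corollary4p6 𝔸 =
    Sep-up (⋀-glb _ _ (λ (α , β) → ⊆𝐖-intro α β)) (Sep-⟦⟧₀ subset-intro)
  , Sep-up (⋀-glb _ _ (λ (α , β) → ⇒-⋀-glb (⊆𝐖-elim α β))) (Sep-⟦⟧₀ subset-elim)
  where
  open ImplicativeAlgebra 𝔸
  open Combinatory 𝔸
  open Realizers 𝔸
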